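{- Let $N$ and $M$ be well-formed labeled portnets and let $(M,\phi)$ be a partial mirror of $N$. Let $S=\textit{compose}(\{N,M\})$ with initial marking $i_S=i_N+i_M$ and final marking $f_S=f_N+f_M$. For all reachable markings $m_0,\dots,m_{n+k}$ and all transitions $t_1,\dots,t_n\in T_N$ and $u_1,\dots,u_k\in T_M$ such that $m_0\xrightarrow{t_1}\cdots\xrightarrow{t_n}m_n\xrightarrow{u_1}\cdots\xrightarrow{u_k}m_{n+k}$ and $\lambda(t_i)=\lambda(u_j)=\textit{receive}$ for all $i,j$, there are markings $m_0',\dots,m_{n+k}'$ such that $m_0=m_0'\xrightarrow{u_1}\cdots\xrightarrow{u_k}m_k'\xrightarrow{t_1}\cdots\xrightarrow{t_n}m_{n+k}'=m_{n+k}$.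
   Context: Petri nets. Labeled Petri net $(P,T,F,\mathcal{L},\mu)$; ${}^\bullet x=\{y\mid (y,x)\in F\}$, $x^\bullet=\{y\mid (x,y)\in F\}$; markings $m:P\to\mathbb{N}$; $t$ enabled at $m$ iff ${}^\bullet t\le m$, firing gives $m-{}^\bullet t+t^\bullet$, written $m\xrightarrow{t}m'$. Reachable means reachable from $i_S$. A path is a sequence of nodes with consecutive pairs in $F$. OPNs. $N=(P,I,O,T,F,\textit{init},\textit{fin},\mathcal{L},\mu)$, $P,I,O$ pairwise disjoint, $(P\cup I\cup O,T,F,\mathcal{L},\mu)$ labeled Petri net, ${}^\bullet x=\emptyset$ for $x\in I$, $x^\bullet=\emptyset$ for $x\in O$, each $t$ has ${}^\bullet t\cap I=\emptyset$ or $t^\bullet\cap O=\emptyset$, $\textit{init},\textit{fin}\subseteq P$. $\lambda(t)=\textit{send}$ if $t^\bullet\cap O\ne\emptyset$, $\textit{receive}$ if ${}^\bullet t\cap I\ne\emptyset$, else $\tau$. Skeleton: net on $P,T$ with arcs $F\cap((P\times T)\cup(T\times P))$. Labeled portnet: OPN whose skeleton has each transition with at most one input and one output place and is a workflow net (unique place $i$ with empty preset, unique $f$ with empty postset, all nodes on a path from $i$ to $f$), $\textit{init}=\{i\}$, $\textit{fin}=\{f\}$ (written $i_N,f_N$); each transition connected to exactly one interface place; transitions sharing an interface place share a label; equally labeled transitions are connected to the same interface place(s). Composition: $N,M$ composable iff shared nodes are exactly $(I_N\cup O_N)\cap(I_M\cup O_M)$ and, if $(I_N\cap O_M)\cup(I_M\cap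 O_N)\ne\emptyset$, then $O_N\subseteq I_M$, $O_M\subseteq I_N$, $I_N\cap I_M=O_N\cap O_M=\emptyset$. $\textit{compose}$: places $\bigcup P\cup(\bigcup I\cap\bigcup O)$, inputs $\bigcup I\setminus\bigcup O$, outputs $\bigcup O\setminus\bigcup I$, other components unions. Partial mirror of $N$: $(M,\phi)$, $M$ a labeled portnet, $\phi$ injective from nodes of $M$ to nodes of $N$ with $\phi(P_M)\subseteq P_N$, $\phi(T_M)\subseteq T_N$, $\phi(I_M)\subseteq O_N$, $\phi(O_M)\subseteq I_N$; for $(x,y)\in F_M$: if $x\notin I_M,y\notin O_M$ then $(\phi(x),\phi(y))\in F_N$, if $x\in I_M$ or $y\in O_M$ then $(\phi(y),\phi(x))\in F_N$; $\phi(\textit{init}_M)=\textit{init}_N$, $\phi(\textit{fin}_M)=\textit{fin}_N$; $\mu_M(t)=\mu_N(\phi(t))$; for all $p\in P_M$, $t\in\phi(p)^\bullet$ with $\lambda(t)=\textit{send}$ there is $t'\in p^\bullet$ with $\phi(t')=t$. In $\textit{compose}(\{N,M\})$ each interface place $x$ of $M$ is the same place as $\phi(x)$, and $N,M$ share no other nodes. Directions $\lambda$ of transitions of $N$ and $M$ are taken in $N$ and $M$ respectively. Well-formed labeled portnet: observable choices (distinct $t,t'\in p^\bullet$ have distinct labels); diamond property (for $p\in P$, $t,t'\in p^\bullet$ with $\lambda(t)\ne\lambda(t')$, for all $q\in t^\bullet\cap P$, $q'\in t'^\bullet\cap P$ there are $u\in q^\bullet$, $u'\in q'^\bullet$ with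 $u^\bullet\cap u'^\bullet\ne\emptyset$, $\mu(t)=\mu(u')$, $\mu(t')=\mu(u)$); loop property (for $p\in P$ and distinct $t,t'\in p^\bullet$ with $\lambda(t)=\lambda(t')$, every path $\langle p\rangle\circ\pi$ whose transitions are $\langle t\rangle\circ\sigma\circ\langle t''\rangle$ with $\mu(t'')=\mu(t')$ and no transition of $\sigma$ labeled $\mu(t')$ contains a transition of direction $\ne\lambda(t)$). -}

module Defs where

open import Data.Nat using (ℕ; _≤_; _+_; _∸_)
open import Data.Nat.Properties using () renaming (_≟_ to _≟ℕ_)
open import Data.Bool using (Bool; true; false; if_then_else_)
open import Data.Product using (Σ; ∃; ∃-syntax; _×_; _,_; proj₁; proj₂)
open import Data.Product.Properties using (≡-dec)
open import Data.Sum using (_⊎_)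
open import Data.Maybe using (just)
open import Data.Empty using (⊥)
open import Data.List using (List; []; _∷_; _++_; [_]; filter; head; last)
open import Data.List.Relation.Unary.All using (All)
open import Data.List.Relation.Unary.Any using (Any; any?)
open import Data.List.Membership.Propositional using (_∈_; _∉_)
open import Data.List.Membership.DecPropositional (_≟ℕ_) using () renaming (_∈?_ to _∈ℕ?_)
open import Relation.Nullary using (¬_; Dec; yes; no)
open import Relation.Nullary.Decidable using (⌊_⌋; ¬?; _×-dec_)
open import Relation.Binary.PropositionalEquality using (_≡_; _≢_)
open import Function.Bundles using (_⇔_)

-- Nodes are named by natural numbers; all node sets are finite lists
-- (read as sets: membership is all that matters).  Labels come from an
-- arbitrary type L.

Node : Set
Node = ℕ

Arc : Set
Arc = ℕ × ℕ

_∈Arc?_ : (a : Arc) (F : List Arc) → Dec (a ∈ F)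
a ∈Arc? F = a ∈A? F
  where open import Data.List.Membership.DecPropositional (≡-dec _≟ℕ_ _≟ℕ_) using () renaming (_∈?_ to _∈A?_)

record OPN (L : Set) : Set where
  field
    P I O T : List Node
    F       : List Arc
    init fin : List Node
    Lab     : List L
    μ       : Node → L
open OPN public

Places : ∀ {L} → OPN L → List Node
Places N = P N ++ I N ++ O N

Iface : ∀ {L} → OPN L → List Node
Iface N = I N ++ O N

Nodes : ∀ {L} → OPN L → List Node
Nodes N = Places N ++ T N

Disjoint : List Node → List Node → Set
Disjoint A B = ∀ x → x ∈ A → x ∈ B → ⊥

Conn : ∀ {L} → OPN L → Node → Node → Set
Conn N x y = ((x , y) ∈ F N) ⊎ ((y , x) ∈ F N)

record IsLabeledPetriNet {L} (N : OPN L) : Set where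
  field
    PT-disj  : Disjoint (Places N) (T N)
    F-bip    : ∀ x y → (x , y) ∈ F N →
               (x ∈ Places N × y ∈ T N) ⊎ (x ∈ T N × y ∈ Places N)
    μ-lab    : ∀ t → t ∈ T N → μ N t ∈ Lab N

record IsOPN {L} (N : OPN L) : Set where
  field
    PI-disj  : Disjoint (P N) (I N)
    PO-disj  : Disjoint (P N) (O N)
    IO-disj  : Disjoint (I N) (O N)
    lpn      : IsLabeledPetriNet N
    I-nopre  : ∀ x y → x ∈ I N → (y , x) ∈ F N → ⊥
    O-nopost : ∀ x y → x ∈ O N → (x , y) ∈ F N → ⊥
    dirs     : ∀ t → t ∈ T N →
               (∀ p → (p , t) ∈ F N → p ∈ I N → ⊥) ⊎
               (∀ p → (t , p) ∈ F N → p ∈ O N → ⊥)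
    init⊆P   : ∀ x → x ∈ init N → x ∈ P N
    fin⊆P    : ∀ x → x ∈ fin N → x ∈ P N

data Dir : Set where
  send receive τ : Dir

SendsOn : ∀ {L} → OPN L → Node → Set
SendsOn N t = Any (λ a → proj₁ a ≡ t × proj₂ a ∈ O N) (F N)

ReceivesOn : ∀ {L} → OPN L → Node → Set
ReceivesOn N t = Any (λ a → proj₂ a ≡ t × proj₁ a ∈ I N) (F N)

sends? : ∀ {L} (N : OPN L) t → Dec (SendsOn N t)
sends? N t = any?
  (λ a → (proj₁ a ≟ℕ t) ×-dec (proj₂ a ∈ℕ? O N)) (F N)

receives? : ∀ {L} (N : OPN L) t → Dec (ReceivesOn N t)
receives? N t = any?
  (λ a → (proj₂ a ≟ℕ t) ×-dec (proj₁ a ∈ℕ? I N)) (F N)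

dir : ∀ {L} → OPN L → Node → Dir
dir N t = if ⌊ sends? N t ⌋ then send
          else (if ⌊ receives? N t ⌋ then receive else τ)

data Path (R : Node → Node → Set) : List Node → Set where
  one  : ∀ x → Path R (x ∷ [])
  cons : ∀ {x y xs} → R x y → Path R (y ∷ xs) → Path R (x ∷ y ∷ xs)

FArc : ∀ {L} → OPN L → Node → Node → Set
FArc N x y = (x , y) ∈ F N

SkArc : ∀ {L} → OPN L → Node → Node → Set
SkArc N x y = (x , y) ∈ F N × ((x ∈ P N × y ∈ T N) ⊎ (x ∈ T N × y ∈ P N))

transitionsOf : ∀ {L} → OPN L → List Node → List Node
transitionsOf N xs = filter (λ x → x ∈ℕ? T N) xs

record IsLabeledPortnet {L} (N : OPN L) : Set where
  field
    opn        : IsOPN N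
    sk-pre≤1   : ∀ t → t ∈ T N → ∀ p q → SkArc N p t → SkArc N q t → p ≡ q
    sk-post≤1  : ∀ t → t ∈ T N → ∀ p q → SkArc N t p → SkArc N t q → p ≡ q
    -- skeleton is a workflow net with source i and sink f
    iN fN      : Node
    iN∈P       : iN ∈ P N
    iN-src     : ∀ x → SkArc N x iN → ⊥
    iN-unique  : ∀ p → p ∈ P N → (∀ x → SkArc N x p → ⊥) → p ≡ iN
    fN∈P       : fN ∈ P N
    fN-snk     : ∀ x → SkArc N fN x → ⊥
    fN-unique  : ∀ p → p ∈ P N → (∀ x → SkArc N p x → ⊥) → p ≡ fN
    on-path    : ∀ x → (x ∈ P N ⊎ x ∈ T N) →
                 ∃[ xs ] (Path (SkArc N) xs × head xs ≡ just iN ×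
                          last xs ≡ just fN × x ∈ xs)
    init≡      : ∀ x → (x ∈ init N) ⇔ (x ≡ iN)
    fin≡       : ∀ x → (x ∈ fin N) ⇔ (x ≡ fN)
    one-iface  : ∀ t → t ∈ T N →
                 ∃[ x ] (x ∈ Iface N × Conn N x t ×
                         (∀ y → y ∈ Iface N → Conn N y t → y ≡ x))
    iface-lab  : ∀ t t' x → t ∈ T N → t' ∈ T N → x ∈ Iface N →
                 Conn N x t → Conn N x t' → μ N t ≡ μ N t'
    lab-iface  : ∀ t t' → t ∈ T N → t' ∈ T N → μ N t ≡ μ N t' →
                 ∀ x → x ∈ Iface N → Conn N x t → Conn N x t'

record IsWellFormed {L} (N : OPN L) : Set where
  field
    portnet    : IsLabeledPortnet N
    observable : ∀ p t t' → p ∈ P N → (p , t) ∈ F N → (p , t') ∈ F N →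
                 t ≢ t' → μ N t ≢ μ N t'
    diamond    : ∀ p t t' → p ∈ P N → (p , t) ∈ F N → (p , t') ∈ F N →
                 dir N t ≢ dir N t' →
                 ∀ q q' → (t , q) ∈ F N → q ∈ P N → (t' , q') ∈ F N → q' ∈ P N →
                 ∃[ u ] ∃[ u' ] ((q , u) ∈ F N × (q' , u') ∈ F N ×
                   (∃[ r ] ((u , r) ∈ F N × (u' , r) ∈ F N)) ×
                   μ N t ≡ μ N u' × μ N t' ≡ μ N u)
    loop       : ∀ p t t' → p ∈ P N → (p , t) ∈ F N → (p , t') ∈ F N →
                 t ≢ t' → dir N t ≡ dir N t' →
                 ∀ π σ t'' → Path (FArc N) (p ∷ π) →
                 transitionsOf N (p ∷ π) ≡ t ∷ σ ++ [ t'' ] →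
                 μ N t'' ≡ μ N t' →
                 All (λ s → μ N s ≢ μ N t') σ →
                 Any (λ s → dir N s ≢ dir N t) (t ∷ σ ++ [ t'' ])

record IsPartialMirror {L} (N M : OPN L) (φ : Node → Node) : Set where
  field
    M-portnet : IsLabeledPortnet M
    φ-inj     : ∀ x y → x ∈ Nodes M → y ∈ Nodes M → φ x ≡ φ y → x ≡ y
    φ-P       : ∀ x → x ∈ P M → φ x ∈ P N
    φ-T       : ∀ x → x ∈ T M → φ x ∈ T N
    φ-I       : ∀ x → x ∈ I M → φ x ∈ O N
    φ-O       : ∀ x → x ∈ O M → φ x ∈ I N
    φ-arc     : ∀ x y → (x , y) ∈ F M → x ∉ I M → y ∉ O M → (φ x , φ y) ∈ F N
    φ-arc-rev : ∀ x y → (x , y) ∈ F M → (x ∈ I M ⊎ y ∈ O M) → (φ y , φ x) ∈ F N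
    φ-init    : ∀ x → (x ∈ init N) ⇔ (∃[ y ] (y ∈ init M × φ y ≡ x))
    φ-fin     : ∀ x → (x ∈ fin N) ⇔ (∃[ y ] (y ∈ fin M × φ y ≡ x))
    φ-μ       : ∀ t → t ∈ T M → μ M t ≡ μ N (φ t)
    φ-send    : ∀ p t → p ∈ P M → (φ p , t) ∈ F N → dir N t ≡ send →
                ∃[ t' ] ((p , t') ∈ F M × φ t' ≡ t)

-- Convention for compose({N, M}): each interface place x of M is the same
-- place as φ(x), and N, M share no other nodes.
record MirrorIdentification {L} (N M : OPN L) (φ : Node → Node) : Set where
  field
    iface-same : ∀ x → x ∈ Iface M → φ x ≡ x
    no-other   : ∀ x → x ∈ Nodes M → x ∈ Nodes N → x ∈ Iface M

compose : ∀ {L} → OPN L → OPN L → OPN L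
compose N M = record
  { P    = P N ++ P M ++ filter (λ x → x ∈ℕ? allO) allI
  ; I    = filter (λ x → ¬? (x ∈ℕ? allO)) allI
  ; O    = filter (λ x → ¬? (x ∈ℕ? allI)) allO
  ; T    = T N ++ T M
  ; F    = F N ++ F M
  ; init = init N ++ init M
  ; fin  = fin N ++ fin M
  ; Lab  = Lab N ++ Lab M
  ; μ    = λ x → if ⌊ x ∈ℕ? T N ⌋ then μ N x else μ M x
  }
  where
  allI = I N ++ I M
  allO = O N ++ O M

Marking : Set
Marking = Node → ℕ

pre : ∀ {L} → OPN L → Node → Marking
pre N t p = if ⌊ (p , t) ∈Arc? F N ⌋ then 1 else 0

post : ∀ {L} → OPN L → Node → Marking
post N t p = if ⌊ (t , p) ∈Arc? F N ⌋ then 1 else 0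

setMarking : List Node → Marking
setMarking A p = if ⌊ p ∈ℕ? A ⌋ then 1 else 0

Fire : ∀ {L} → OPN L → Marking → Node → Marking → Set
Fire N m t m' = t ∈ T N × (∀ p → pre N t p ≤ m p) ×
                (∀ p → m' p ≡ m p ∸ pre N t p + post N t p)

-- m --t1--> ... --tn--> m'  (intermediate markings existentially hidden)
data Run {L} (N : OPN L) : Marking → List Node → Marking → Set where
  done : ∀ {m} → Run N m [] m
  step : ∀ {m m₁ m₂ t ts} → Fire N m t m₁ → Run N m₁ ts m₂ → Run N m (t ∷ ts) m₂

data Reachable {L} (N : OPN L) (i : Marking) : Marking → Set where
  base : ∀ {m} → (∀ p → m p ≡ i p) → Reachable N i m
  next : ∀ {m t m'} → Reachable N i m → Fire N m t m' → Reachable N i m'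

{-# OPTIONS --safe #-}
module Submission where

-- Firing t and then u can be reordered whenever t neither consumes from nor
-- produces into a place of •u: then u was already enabled before t, and on
-- every place the two token updates commute.  An input place that a
-- transition u of M shares with N lies in I M = O N (places in O M have no
-- postset), and a receiving transition t of N touches no place of O N (O N
-- has no postset, and t does not send).  So every u can be moved in front of
-- every t, one adjacent pair at a time.

open import Defs
open import Data.Nat using (_+_; _∸_; _≤_; z≤n)
open import Data.Nat.Properties
  using (+-∸-comm; +-identityʳ; ≤-trans; m≤m+n; +-commutativeSemigroup)
open import Algebra.Properties.CommutativeSemigroup +-commutativeSemigroup
  using (xy∙z≈xz∙y)
open import Data.Product using (∃-syntax; _×_; _,_; proj₁; proj₂)
open import Data.Sum using (_⊎_; inj₁; inj₂)
open import Data.Empty using (⊥-elim)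
open import Data.List using (List)
open import Data.List.Relation.Unary.All as All using (All; []; _∷_)
import Data.List.Relation.Unary.Any as Any
open import Data.List.Membership.Propositional using (_∈_; _∉_)
open import Data.List.Membership.Propositional.Properties using (∈-++⁻; ∈-++⁺ˡ; ∈-++⁺ʳ)
open import Function using (_∘_)
open import Relation.Nullary using (¬_; yes; no)
open import Relation.Binary.PropositionalEquality
  using (_≡_; refl; sym; trans; cong; subst; module ≡-Reasoning)

swap-updates : ∀ {m a b c d} → a ≤ m → c ≤ m ∸ a + b → c ≡ 0 ⊎ (a ≡ 0 × b ≡ 0) →
               c ≤ m × a ≤ m ∸ c + d × (m ∸ a + b) ∸ c + d ≡ (m ∸ c + d) ∸ a + b
swap-updates {m} {a} {b} {d = d} a≤m _ (inj₁ refl) =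
  z≤n , ≤-trans a≤m (m≤m+n m d) , updates-commute
  where
  open ≡-Reasoning
  updates-commute : m ∸ a + b + d ≡ (m + d) ∸ a + b
  updates-commute = begin
    m ∸ a + b + d    ≡⟨ xy∙z≈xz∙y (m ∸ a) b d ⟩
    m ∸ a + d + b    ≡⟨ cong (_+ b) (sym (+-∸-comm d a≤m)) ⟩
    (m + d) ∸ a + b  ∎
swap-updates {m} {c = c} {d} _ c≤m+0 (inj₂ (refl , refl)) =
  subst (c ≤_) (+-identityʳ m) c≤m+0 , z≤n ,
  trans (cong (λ k → k ∸ c + d) (+-identityʳ m)) (sym (+-identityʳ _))

TouchesNoInputOf : ∀ {L} → OPN L → Node → Node → Set
TouchesNoInputOf C t u = ∀ p → (p , u) ∈ F C → (p , t) ∉ F C × (t , p) ∉ F C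

pre-absent : ∀ {L} (C : OPN L) {t p} → (p , t) ∉ F C → pre C t p ≡ 0
pre-absent C {t} {p} p∉•t with (p , t) ∈Arc? F C
... | yes p∈•t = ⊥-elim (p∉•t p∈•t)
... | no _     = refl

post-absent : ∀ {L} (C : OPN L) {t p} → (t , p) ∉ F C → post C t p ≡ 0
post-absent C {t} {p} p∉t• with (t , p) ∈Arc? F C
... | yes p∈t• = ⊥-elim (p∉t• p∈t•)
... | no _     = refl

untouched-place : ∀ {L} (C : OPN L) {t u} → TouchesNoInputOf C t u → ∀ p →
                  pre C u p ≡ 0 ⊎ (pre C t p ≡ 0 × post C t p ≡ 0)
untouched-place C {t} {u} t∤•u p with (p , u) ∈Arc? F C
... | no _     = inj₁ refl
... | yes p∈•u = inj₂ (pre-absent C (proj₁ (t∤•u p p∈•u)) , post-absent C (proj₂ (t∤•u p p∈•u)))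

fire-swap : ∀ {L} (C : OPN L) {t u m₀ m₁ m₂} → TouchesNoInputOf C t u →
            Fire C m₀ t m₁ → Fire C m₁ u m₂ → ∃[ m ] (Fire C m₀ u m × Fire C m t m₂)
fire-swap C {t} {u} {m₀} t∤•u (t∈T , t-enabled , m₁≡) (u∈T , u-enabled , m₂≡) =
  (λ p → m₀ p ∸ pre C u p + post C u p) ,
  (u∈T , (λ p → proj₁ (swapped p)) , λ _ → refl) ,
  (t∈T , (λ p → proj₁ (proj₂ (swapped p))) , λ p →
     trans (m₂≡ p) (trans (cong (λ k → k ∸ pre C u p + post C u p) (m₁≡ p))
                          (proj₂ (proj₂ (swapped p)))))
  where
  swapped : ∀ p → let a = pre C t p; b = post C t p; c = pre C u p; d = post C u p in
            c ≤ m₀ p × a ≤ m₀ p ∸ c + d × (m₀ p ∸ a + b) ∸ c + d ≡ (m₀ p ∸ c + d) ∸ a + b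
  swapped p = swap-updates {d = post C u p} (t-enabled p)
                    (subst (pre C u p ≤_) (m₁≡ p) (u-enabled p)) (untouched-place C t∤•u p)

module _ {L} (C : OPN L) {A B : Node → Set}
         (commutes : ∀ {t u} → A t → B u → TouchesNoInputOf C t u) where

  run-fire-swap : ∀ {ts u m₀ m₁ m₂} → All A ts → B u →
                  Run C m₀ ts m₁ → Fire C m₁ u m₂ → ∃[ m ] (Fire C m₀ u m × Run C m ts m₂)
  run-fire-swap [] _ done fire-u = _ , fire-u , done
  run-fire-swap (At ∷ Ats) Bu (step fire-t run) fire-u
    with run-fire-swap Ats Bu run fire-u
  ... | _ , fire-u′ , run′ with fire-swap C (commutes At Bu) fire-t fire-u′
  ... | _ , fire-u″ , fire-t′ = _ , fire-u″ , step fire-t′ run′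

  run-swap : ∀ {ts us m₀ m₁ m₂} → All A ts → All B us →
             Run C m₀ ts m₁ → Run C m₁ us m₂ → ∃[ m ] (Run C m₀ us m × Run C m ts m₂)
  run-swap _ [] run-ts done = _ , done , run-ts
  run-swap Ats (Bu ∷ Bus) run-ts (step fire-u run-us)
    with run-fire-swap Ats Bu run-ts fire-u
  ... | _ , fire-u′ , run-ts′ with run-swap Ats Bus run-ts′ run-us
  ... | _ , run-us′ , run-ts″ = _ , step fire-u′ run-us′ , run-ts″

arc-endpoints : ∀ {L} {K : OPN L} → IsLabeledPetriNet K → ∀ {x y} → (x , y) ∈ F K →
                x ∈ Nodes K × y ∈ Nodes K
arc-endpoints {K = K} lpn {x} {y} xy∈F with IsLabeledPetriNet.F-bip lpn x y xy∈F
... | inj₁ (x∈P , y∈T) = ∈-++⁺ˡ x∈P , ∈-++⁺ʳ (Places K) y∈T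
... | inj₂ (x∈T , y∈P) = ∈-++⁺ʳ (Places K) x∈T , ∈-++⁺ˡ y∈P

receive⇒¬SendsOn : ∀ {L} (N : OPN L) {t} → dir N t ≡ receive → ¬ SendsOn N t
receive⇒¬SendsOn N {t} t-receives sends with sends? N t
receive⇒¬SendsOn N () _ | yes _
... | no ¬sends = ¬sends sends

module Composition {L} (N M : OPN L) (φ : Node → Node)
                   (opnN : IsOPN N) (opnM : IsOPN M)
                   (mirror : IsPartialMirror N M φ) (ident : MirrorIdentification N M φ) where

  open IsPartialMirror mirror using (φ-I; φ-O)
  open MirrorIdentification ident using (iface-same; no-other)

  C : OPN L
  C = compose N M

  lpnN : IsLabeledPetriNet N
  lpnN = IsOPN.lpn opnN

  lpnM : IsLabeledPetriNet M
  lpnM = IsOPN.lpn opnM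

  Iface-M⊆Places-N : ∀ {x} → x ∈ Iface M → x ∈ Places N
  Iface-M⊆Places-N {x} x∈Iface with ∈-++⁻ (I M) x∈Iface
  ... | inj₁ x∈I = ∈-++⁺ʳ (P N) (∈-++⁺ʳ (I N) (subst (_∈ O N) (iface-same x x∈Iface) (φ-I x x∈I)))
  ... | inj₂ x∈O = ∈-++⁺ʳ (P N) (∈-++⁺ˡ (subst (_∈ I N) (iface-same x x∈Iface) (φ-O x x∈O)))

  T-N∉Nodes-M : ∀ {t} → t ∈ T N → t ∉ Nodes M
  T-N∉Nodes-M {t} t∈T t∈M =
    IsLabeledPetriNet.PT-disj lpnN t (Iface-M⊆Places-N (no-other t t∈M (∈-++⁺ʳ (Places N) t∈T))) t∈T

  T-M∉Nodes-N : ∀ {u} → u ∈ T M → u ∉ Nodes N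
  T-M∉Nodes-N {u} u∈T u∈N =
    IsLabeledPetriNet.PT-disj lpnM u (∈-++⁺ʳ (P M) (no-other u (∈-++⁺ʳ (Places M) u∈T) u∈N)) u∈T

  arc-of-N : ∀ {x y} → (x , y) ∈ F C → ¬ (x ∈ Nodes M × y ∈ Nodes M) → (x , y) ∈ F N
  arc-of-N xy∈F ¬inM with ∈-++⁻ (F N) xy∈F
  ... | inj₁ xy∈N = xy∈N
  ... | inj₂ xy∈M = ⊥-elim (¬inM (arc-endpoints lpnM xy∈M))

  arc-of-M : ∀ {x y} → (x , y) ∈ F C → ¬ (x ∈ Nodes N × y ∈ Nodes N) → (x , y) ∈ F M
  arc-of-M xy∈F ¬inN with ∈-++⁻ (F N) xy∈F
  ... | inj₁ xy∈N = ⊥-elim (¬inN (arc-endpoints lpnN xy∈N))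
  ... | inj₂ xy∈M = xy∈M

  shared-input∈O-N : ∀ {p u} → (p , u) ∈ F M → p ∈ Nodes N → p ∈ O N
  shared-input∈O-N {p} {u} pu∈F p∈N with ∈-++⁻ (I M) p∈Iface
    where
    p∈Iface : p ∈ Iface M
    p∈Iface = no-other p (proj₁ (arc-endpoints lpnM pu∈F)) p∈N
  ... | inj₁ p∈I = subst (_∈ O N) (iface-same p (∈-++⁺ˡ p∈I)) (φ-I p p∈I)
  ... | inj₂ p∈O = ⊥-elim (IsOPN.O-nopost opnM p u p∈O pu∈F)

  receive-touches-no-input : ∀ {t u} → t ∈ T N × dir N t ≡ receive → u ∈ T M →
                             TouchesNoInputOf C t u
  receive-touches-no-input {t} {u} (t∈T , t-receives) u∈T p pu∈F =
    (λ pt∈F → let pt∈N = arc-of-N pt∈F (T-N∉Nodes-M t∈T ∘ proj₂) in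
       IsOPN.O-nopost opnN p t (p∈O (proj₁ (arc-endpoints lpnN pt∈N))) pt∈N) ,
    (λ tp∈F → let tp∈N = arc-of-N tp∈F (T-N∉Nodes-M t∈T ∘ proj₁) in
       receive⇒¬SendsOn N t-receives
         (Any.map (λ { refl → refl , p∈O (proj₂ (arc-endpoints lpnN tp∈N)) }) tp∈N))
    where
    p∈O : p ∈ Nodes N → p ∈ O N
    p∈O = shared-input∈O-N (arc-of-M pu∈F (T-M∉Nodes-N u∈T ∘ proj₂))

lemma4 : {L : Set} (N M : OPN L) (φ : Node → Node) →
    IsWellFormed N → IsWellFormed M →
    IsPartialMirror N M φ → MirrorIdentification N M φ →
    (m₀ mₙ mₙₖ : Marking) (ts us : List Node) →
    Reachable (compose N M) (λ p → setMarking (init N) p + setMarking (init M) p) m₀ →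
    Reachable (compose N M) (λ p → setMarking (init N) p + setMarking (init M) p) mₙ →
    Reachable (compose N M) (λ p → setMarking (init N) p + setMarking (init M) p) mₙₖ →
    All (λ t → t ∈ T N) ts → All (λ u → u ∈ T M) us →
    All (λ t → dir N t ≡ receive) ts → All (λ u → dir M u ≡ receive) us →
    Run (compose N M) m₀ ts mₙ → Run (compose N M) mₙ us mₙₖ →
    ∃[ m' ] (Run (compose N M) m₀ us m' × Run (compose N M) m' ts mₙₖ)
lemma4 N M φ wfN wfM mirror ident _ _ _ _ _ _ _ _ ts∈T us∈T ts-receive _ run-ts run-us =
  run-swap C receive-touches-no-input (All.zip (ts∈T , ts-receive)) us∈T run-ts run-us
  where
  opn : ∀ {K} → IsWellFormed K → IsOPN K
  opn = IsLabeledPortnet.opn ∘ IsWellFormed.portnet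
  open Composition N M φ (opn wfN) (opn wfM) mirror ident
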